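{- Let $q$ be an integer with $q \ge 3$, let $1 \le t_1 < \cdots < t_k < n$ be integers, and let $G = G_n\langle t_1, \ldots, t_k\rangle$. Then $G$ is $K_q$-free if and only if for every subset $S \subseteq \{1, \ldots, k\}$ with $|S| = q-1$ there is a pair of distinct integers $a, b \in S$ such that $|t_a - t_b| \notin \{t_1, \ldots, t_k\}$.
   Context: For integers $1 \le t_1 < \cdots < t_k < n$, the Toeplitz graph $G_n\langle t_1, \ldots, t_k\rangle$ is the simple graph with vertex set $\{1, \ldots, n\}$ in which distinct vertices $i,j$ are adjacent iff $|i-j| \in \{t_1, \ldots, t_k\}$. $K_q$-free means having no complete subgraph on $q$ vertices. -}

module Defs where

open import Data.Nat using (ℕ; _≤_; _<_; ∣_-_∣)
open import Data.Fin using (Fin; zero; suc)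
import Data.Fin as F
open import Data.Product using (Σ; ∃; _×_)
open import Relation.Binary.PropositionalEquality using (_≡_; _≢_)
open import Relation.Nullary using (¬_)

StrictlyIncreasing : ∀ {k} → (Fin k → ℕ) → Set
StrictlyIncreasing {k} t = ∀ (a b : Fin k) → a F.< b → t a < t b

ValidParams : (n k : ℕ) → (Fin k → ℕ) → Set
ValidParams n k t = StrictlyIncreasing t × (∀ a → 1 ≤ t a) × (∀ a → t a < n)

InT : ∀ {k} → (Fin k → ℕ) → ℕ → Set
InT {k} t d = ∃ λ (c : Fin k) → t c ≡ d

-- Toeplitz graph G_n⟨t₁,…,t_k⟩ on vertex set {1,…,n}
Vertex : ℕ → ℕ → Set
Vertex n v = 1 ≤ v × v ≤ n

Adj : ∀ {k} → (Fin k → ℕ) → ℕ → ℕ → Set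
Adj t i j = i ≢ j × InT t ∣ i - j ∣

IsClique : ∀ {k} (n : ℕ) (t : Fin k → ℕ) (q : ℕ) → (Fin q → ℕ) → Set
IsClique n t q f =
  (∀ x → Vertex n (f x)) × (∀ x y → x ≢ y → Adj t (f x) (f y))

KFree : ∀ {k} (n : ℕ) (t : Fin k → ℕ) (q : ℕ) → Set
KFree n t q = ¬ (∃ λ (f : Fin q → ℕ) → IsClique n t q f)

module Submission where

-- A clique of G_n⟨T⟩ with least vertex m is m together with m + d for q − 1 distinct
-- d ∈ T whose pairwise differences again lie in T; conversely any such d's give the
-- clique {1} ∪ {1 + d}. Hence K_q ⊆ G exactly when some (q−1)-subset of T is closed
-- under differences, and since everything is finite and decidable the negation of the
-- latter produces an explicit pair with |t_a − t_b| ∉ T.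

open import Defs
open import Data.Nat using (ℕ; zero; suc; _≤_; _∸_; ∣_-_∣; z≤n; s≤s; _≤?_)
open import Data.Nat.Properties using (≤-refl; ≤-trans; <⇒≤; <⇒≢; ≰⇒>; <-irrefl; ∸-cancelʳ-≡; m≤n⇒∣m-n∣≡n∸m; ∣-∣-comm; suc-injective)
import Data.Nat.Properties as ℕ
open import Data.Fin using (Fin; zero; suc; punchIn)
import Data.Fin.Properties as Fin
open import Data.Fin.Subset using (Subset; inside; outside; _∈_; _∉_; ∣_∣; ⊥)
open import Data.Fin.Subset.Properties using (_∈?_; ∉⊥; ∣⊥∣≡0)
open import Data.Vec using (_∷_; []; here; there)
open import Data.Product using (∃; _×_; _,_; proj₁; proj₂)
open import Data.Sum using (_⊎_; inj₁; inj₂)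
open import Data.Empty using (⊥-elim)
open import Function using (_∘_)
open import Function.Definitions using (Injective)
open import Function.Bundles using (_⇔_; mk⇔)
open import Relation.Binary using (tri<; tri≈; tri>)
open import Relation.Binary.PropositionalEquality using (_≡_; _≢_; refl; sym; trans; cong; cong₂; subst)
open import Relation.Nullary using (¬_; Dec; yes; no)
open import Relation.Nullary.Decidable using (_×-dec_; ¬?; decidable-stable)

insert : ∀ {k} → Fin k → Subset k → Subset k
insert zero    (_ ∷ p) = inside ∷ p
insert (suc x) (s ∷ p) = s ∷ insert x p

∣insert∣ : ∀ {k} (x : Fin k) (p : Subset k) → x ∉ p → ∣ insert x p ∣ ≡ suc ∣ p ∣
∣insert∣ zero    (inside  ∷ p) x∉p = ⊥-elim (x∉p here)
∣insert∣ zero    (outside ∷ p) x∉p = refl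
∣insert∣ (suc x) (inside  ∷ p) x∉p = cong suc (∣insert∣ x p (x∉p ∘ there))
∣insert∣ (suc x) (outside ∷ p) x∉p = ∣insert∣ x p (x∉p ∘ there)

∈insert⇒≡⊎∈ : ∀ {k} (x y : Fin k) (p : Subset k) → y ∈ insert x p → y ≡ x ⊎ y ∈ p
∈insert⇒≡⊎∈ zero    zero    (s ∷ p) _         = inj₁ refl
∈insert⇒≡⊎∈ zero    (suc y) (s ∷ p) (there m) = inj₂ (there m)
∈insert⇒≡⊎∈ (suc x) zero    (s ∷ p) here      = inj₂ here
∈insert⇒≡⊎∈ (suc x) (suc y) (s ∷ p) (there m) with ∈insert⇒≡⊎∈ x y p m
... | inj₁ y≡x = inj₁ (cong suc y≡x)
... | inj₂ y∈p = inj₂ (there y∈p)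

enumerate : ∀ {k} (p : Subset k) →
  ∃ λ (g : Fin ∣ p ∣ → Fin k) → Injective _≡_ _≡_ g × (∀ i → g i ∈ p)
enumerate []            = (λ ()) , (λ {}) , (λ ())
enumerate (outside ∷ p) with enumerate p
... | g , g-inj , g∈p = suc ∘ g , g-inj ∘ Fin.suc-injective , there ∘ g∈p
enumerate (inside ∷ p) with enumerate p
... | g , g-inj , g∈p = h , h-inj , h∈p
  where
  h : Fin (suc ∣ p ∣) → Fin _
  h zero    = zero
  h (suc i) = suc (g i)

  h-inj : Injective _≡_ _≡_ h
  h-inj {zero}  {zero}  _ = refl
  h-inj {suc i} {suc j} e = cong suc (g-inj (Fin.suc-injective e))

  h∈p : ∀ i → h i ∈ (inside ∷ p)
  h∈p zero    = here
  h∈p (suc i) = there (g∈p i)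

image : ∀ {m k} (g : Fin m → Fin k) → Injective _≡_ _≡_ g →
  ∃ λ (p : Subset k) → ∣ p ∣ ≡ m × (∀ {a} → a ∈ p → ∃ λ i → g i ≡ a)
image {zero}  {k} g _     = ⊥ , ∣⊥∣≡0 k , ⊥-elim ∘ ∉⊥
image {suc m}     g g-inj with image (g ∘ suc) (Fin.suc-injective ∘ g-inj)
... | p , ∣p∣≡m , onto = insert (g zero) p , ∣image∣ , onto′
  where
  g0∉p : g zero ∉ p
  g0∉p g0∈p with onto g0∈p
  ... | i , e with g-inj e
  ... | ()

  ∣image∣ : ∣ insert (g zero) p ∣ ≡ suc m
  ∣image∣ = trans (∣insert∣ (g zero) p g0∉p) (cong suc ∣p∣≡m)

  onto′ : ∀ {a} → a ∈ insert (g zero) p → ∃ λ i → g i ≡ a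
  onto′ {a} a∈ with ∈insert⇒≡⊎∈ (g zero) a p a∈
  ... | inj₁ a≡g0 = zero , sym a≡g0
  ... | inj₂ a∈p  with onto a∈p
  ... | i , e = suc i , e

argmin : ∀ {p} (f : Fin (suc p) → ℕ) → ∃ λ m → ∀ x → f m ≤ f x
argmin {zero}  f = zero , λ { zero → ≤-refl }
argmin {suc p} f with argmin (f ∘ suc)
... | m , min with f zero ≤? f (suc m)
... | yes f0≤ = zero  , λ { zero → ≤-refl ; (suc x) → ≤-trans f0≤ (min x) }
... | no  f0≰ = suc m , λ { zero → <⇒≤ (≰⇒> f0≰) ; (suc x) → min x }

∣m∸o-n∸o∣≡∣m-n∣ : ∀ {m n o} → o ≤ m → o ≤ n → ∣ m ∸ o - n ∸ o ∣ ≡ ∣ m - n ∣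
∣m∸o-n∸o∣≡∣m-n∣ z≤n       z≤n       = refl
∣m∸o-n∸o∣≡∣m-n∣ (s≤s o≤m) (s≤s o≤n) = ∣m∸o-n∸o∣≡∣m-n∣ o≤m o≤n

InT? : ∀ {k} (t : Fin k → ℕ) (d : ℕ) → Dec (InT t d)
InT? t d = Fin.any? (λ c → t c ℕ.≟ d)

strictlyIncreasing⇒injective : ∀ {k} {t : Fin k → ℕ} → StrictlyIncreasing t → Injective _≡_ _≡_ t
strictlyIncreasing⇒injective {t = t} inc {a} {b} e with Fin.<-cmp a b
... | tri< a<b _ _ = ⊥-elim (<-irrefl e (inc a b a<b))
... | tri≈ _ a≡b _ = a≡b
... | tri> _ _ b<a = ⊥-elim (<-irrefl (sym e) (inc b a b<a))

clique-injective : ∀ {n k q} {t : Fin k → ℕ} {f : Fin q → ℕ} → IsClique n t q f → Injective _≡_ _≡_ f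
clique-injective (_ , adj) {x} {y} e with x Fin.≟ y
... | yes x≡y = x≡y
... | no  x≢y = ⊥-elim (proj₁ (adj x y x≢y) e)

DifferencesInT : ∀ {k p} → (Fin k → ℕ) → (Fin p → Fin k) → Set
DifferencesInT t g = ∀ i j → i ≢ j → InT t ∣ t (g i) - t (g j) ∣

cone : ∀ {k p} → (Fin k → ℕ) → (Fin p → Fin k) → Fin (suc p) → ℕ
cone t g zero    = 1
cone t g (suc i) = suc (t (g i))

-- g is indexed by Fin (suc p) only so that some 1 ≤ t (g i) < n shows the apex 1 is a vertex.
cone-isClique : ∀ {n k p} {t : Fin k → ℕ} → ValidParams n k t →
  (g : Fin (suc p) → Fin k) → Injective _≡_ _≡_ g → DifferencesInT t g →
  IsClique n t (suc (suc p)) (cone t g)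
cone-isClique {n} {t = t} (inc , pos , bnd) g g-inj closed = vertex , adj
  where
  vertex : ∀ x → Vertex n (cone t g x)
  vertex zero    = s≤s z≤n , ≤-trans (pos (g zero)) (<⇒≤ (bnd (g zero)))
  vertex (suc i) = s≤s z≤n , bnd (g i)

  adj : ∀ x y → x ≢ y → Adj t (cone t g x) (cone t g y)
  adj zero    zero    x≢y = ⊥-elim (x≢y refl)
  adj zero    (suc j) _   = <⇒≢ (s≤s (pos (g j))) , g j , refl
  adj (suc i) zero    _   = <⇒≢ (s≤s (pos (g i))) ∘ sym , g i , ∣-∣-comm 0 (t (g i))
  adj (suc i) (suc j) x≢y =
    x≢y ∘ cong suc ∘ g-inj ∘ strictlyIncreasing⇒injective inc ∘ suc-injective ,
    closed i j (x≢y ∘ cong suc)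

clique⇒differencesInT : ∀ {n k p} {t : Fin k → ℕ} {f : Fin (suc p) → ℕ} → IsClique n t (suc p) f →
  ∃ λ (g : Fin p → Fin k) → Injective _≡_ _≡_ g × DifferencesInT t g
clique⇒differencesInT {t = t} {f} clique@(_ , adj) = g , g-inj , closed
  where
  m   = proj₁ (argmin f)
  min = proj₂ (argmin f)

  edge : ∀ i → Adj t (f m) (f (punchIn m i))
  edge i = adj m (punchIn m i) (Fin.punchInᵢ≢i m i ∘ sym)

  g : Fin _ → Fin _
  g i = proj₁ (proj₂ (edge i))

  t∘g : ∀ i → t (g i) ≡ f (punchIn m i) ∸ f m
  t∘g i = trans (proj₂ (proj₂ (edge i))) (m≤n⇒∣m-n∣≡n∸m (min (punchIn m i)))

  g-inj : Injective _≡_ _≡_ g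
  g-inj {i} {j} e = Fin.punchIn-injective m i j (clique-injective clique
    (∸-cancelʳ-≡ (min _) (min _) (trans (sym (t∘g i)) (trans (cong t e) (t∘g j)))))

  closed : DifferencesInT t g
  closed i j i≢j = subst (InT t) (sym difference) (proj₂ (adj x y (i≢j ∘ Fin.punchIn-injective m i j)))
    where
    x = punchIn m i
    y = punchIn m j
    difference : ∣ t (g i) - t (g j) ∣ ≡ ∣ f x - f y ∣
    difference = trans (cong₂ ∣_-_∣ (t∘g i) (t∘g j)) (∣m∸o-n∸o∣≡∣m-n∣ (min x) (min y))

NonDifferencePair : ∀ {k} → (Fin k → ℕ) → Subset k → Set
NonDifferencePair t S = ∃ λ a → ∃ λ b → a ∈ S × b ∈ S × a ≢ b × ¬ InT t ∣ t a - t b ∣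

nonDifferencePair? : ∀ {k} (t : Fin k → ℕ) (S : Subset k) → Dec (NonDifferencePair t S)
nonDifferencePair? t S = Fin.any? λ a → Fin.any? λ b →
  (a ∈? S) ×-dec (b ∈? S) ×-dec ¬? (a Fin.≟ b) ×-dec ¬? (InT? t ∣ t a - t b ∣)

¬nonDifferencePair⇒clique : ∀ {n k p} {t : Fin k → ℕ} → ValidParams n k t →
  (S : Subset k) → ∣ S ∣ ≡ suc p → ¬ NonDifferencePair t S → ∃ (IsClique n t (suc (suc p)))
¬nonDifferencePair⇒clique {t = t} valid S ∣S∣≡ ¬pair with ∣ S ∣ | ∣S∣≡ | enumerate S
... | _ | refl | g , g-inj , g∈S = cone t g , cone-isClique valid g g-inj closed
  where
  closed : DifferencesInT t g
  closed i j i≢j = decidable-stable (InT? t _) λ ∉T →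
    ¬pair (g i , g j , g∈S i , g∈S j , i≢j ∘ g-inj , ∉T)

theorem5 : (q n k : ℕ) (t : Fin k → ℕ) → 3 ≤ q → ValidParams n k t →
    KFree n t q ⇔
    (∀ (S : Subset k) → ∣ S ∣ ≡ q ∸ 1 →
    ∃ λ (a : Fin k) → ∃ λ (b : Fin k) →
    a ∈ S × b ∈ S × a ≢ b × ¬ InT t ∣ t a - t b ∣)
theorem5 (suc (suc (suc r))) n k t (s≤s (s≤s (s≤s _))) valid = mk⇔ to from
  where
  to : KFree n t (suc (suc (suc r))) → ∀ S → ∣ S ∣ ≡ suc (suc r) → NonDifferencePair t S
  to kfree S ∣S∣≡ = decidable-stable (nonDifferencePair? t S) (kfree ∘ ¬nonDifferencePair⇒clique valid S ∣S∣≡)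

  from : (∀ S → ∣ S ∣ ≡ suc (suc r) → NonDifferencePair t S) → KFree n t (suc (suc (suc r)))
  from pairIn (f , clique) with clique⇒differencesInT clique
  ... | g , g-inj , closed with image g g-inj
  ... | S , ∣S∣≡ , onto with pairIn S ∣S∣≡
  ... | a , b , a∈S , b∈S , a≢b , ∉T with onto a∈S | onto b∈S
  ... | i , refl | j , refl = ∉T (closed i j (a≢b ∘ cong g))
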